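{- If $G$ is a graph with minimum degree $\delta(G)\ge 2$ and girth $g(G)\ge 5$, and $H$ is any graph, then $\chi_{\mu_2}(G\circ H)\le \chi_{\mu_2}(G)$. This bound is sharp (equality holds for some such $G$ and every $H$).
   Context: All graphs are finite, simple and undirected. The girth is the length of a shortest cycle ($\infty$ for forests). A $u,v$-geodesic is a shortest $u,v$-path. A set $M\subseteq V(X)$ is a $2$-distance mutual-visibility set of $X$ if for every two distinct $u,v\in M$ there is a $u,v$-geodesic of length at most $2$ none of whose internal vertices lies in $M$; $\chi_{\mu_2}(X)$ is the minimum number of parts in a partition of $V(X)$ into such sets. The lexicographic product $G\circ H$ has vertex set $V(G)\times V(H)$, with $(g,h)$ and $(g',h')$ adjacent iff either $gg'\in E(G)$, or $g=g'$ and $hh'\in E(H)$. -}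

module Defs where

open import Data.Nat using (ℕ; zero; suc; _+_; _*_; _≤_)
open import Data.Bool using (Bool; true; false; T; _∨_; _∧_; if_then_else_)
open import Data.Fin using (Fin; remQuot)
open import Data.Fin.Properties using (_≟_)
open import Data.List using (List; []; _∷_; _++_; [_]; length; map; allFin)
open import Data.Nat.ListAction using (sum)
open import Data.Unit using (⊤)
open import Data.Empty using (⊥)
open import Data.List.Relation.Unary.Unique.Propositional using (Unique)
open import Data.Product using (Σ; ∃; _×_; _,_; proj₁; proj₂)
open import Data.Sum using (_⊎_)
open import Relation.Nullary using (¬_; ⌊_⌋)
open import Relation.Binary.PropositionalEquality using (_≡_; _≢_)

record Graph : Set where
  constructor mkGraph
  field
    n : ℕ
    E : Fin n → Fin n → Bool
open Graph public

V : Graph → Set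
V X = Fin (n X)

Adj : (X : Graph) → V X → V X → Set
Adj X u v = T (E X u v)

IsSimple : Graph → Set
IsSimple X = (∀ u v → E X u v ≡ E X v u) × (∀ u → E X u u ≡ false)

degree : (X : Graph) → V X → ℕ
degree X v = sum (map (λ w → if E X v w then 1 else 0) (allFin (n X)))

MinDegreeAtLeast : ℕ → Graph → Set
MinDegreeAtLeast d X = ∀ v → d ≤ degree X v

Walk : (X : Graph) → List (V X) → Set
Walk X []           = ⊤
Walk X (x ∷ [])     = ⊤
Walk X (x ∷ y ∷ xs) = Adj X x y × Walk X (y ∷ xs)

IsCycle : (X : Graph) → List (V X) → Set
IsCycle X []       = ⊥
IsCycle X (x ∷ xs) =
  3 ≤ length (x ∷ xs) × Unique (x ∷ xs) × Walk X ((x ∷ xs) ++ [ x ])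

-- girth ≥ g : every cycle has length at least g (vacuous for forests, girth = ∞)
GirthAtLeast : ℕ → Graph → Set
GirthAtLeast g X = ∀ (c : List (V X)) → IsCycle X c → g ≤ length c

-- lexicographic product G ∘ H on Fin (n G * n H), where the vertex i
-- corresponds to the pair remQuot (n H) i = (g , h)
lex : Graph → Graph → Graph
lex G H = mkGraph (n G * n H) e
  where
  e : Fin (n G * n H) → Fin (n G * n H) → Bool
  e i j with remQuot {n G} (n H) i | remQuot {n G} (n H) j
  ... | (g , h) | (g' , h') = E G g g' ∨ (⌊ g ≟ g' ⌋ ∧ E H h h')

-- A geodesic of
-- length 1 is an edge uv; a geodesic of length 2 is a path u w v with u, v
-- distinct and non-adjacent (so that d(u,v) = 2).
IsMV2 : (X : Graph) → (V X → Set) → Set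
IsMV2 X M = ∀ u v → M u → M v → u ≢ v →
  Adj X u v ⊎ (¬ Adj X u v × Σ (V X) λ w → Adj X u w × Adj X w v × ¬ M w)

-- a partition of V(X) into (at most) k 2-distance mutual-visibility sets,
-- given as the colour-class map c; the classes are c⁻¹(i)
HasMV2Partition : Graph → ℕ → Set
HasMV2Partition X k =
  Σ (V X → Fin k) λ c → ∀ (i : Fin k) → IsMV2 X (λ x → c x ≡ i)

ChiMu2 : Graph → ℕ → Set
ChiMu2 X k = HasMV2Partition X k × (∀ j → HasMV2Partition X j → k ≤ j)

{-# OPTIONS --safe #-}
-- Colour (g , h) by the colour of g in an optimal partition of G. By girth ≥ 5 a
-- 2-distance mutual-visibility class containing g holds at most one neighbour of g (two
-- would close a triangle or a 4-cycle through g), so δ(G) ≥ 2 gives every g a neighbour x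
-- outside its class. Then (g , h) and (g , h') see each other through (x , h), and
-- vertices in different fibres through the lift of a visibility path of G.
-- Sharpness: the parity classes of C₅ show χ_{μ2}(C₅) ≤ 2, while C₅ ∘ H has two distinct
-- non-adjacent vertices, so its whole vertex set is not a single class.
module Submission where

open import Defs
open import Data.Nat using (ℕ; zero; suc; _≤_; z≤n; s≤s; _≤?_; _%_)
open import Data.Nat.DivMod using (_mod_)
open import Data.Nat.Properties using (≤-antisym; ≤-pred; module ≤-Reasoning)
import Data.Nat.Properties as ℕ
open import Data.Bool using (Bool; true; false; T; _∨_; _∧_; if_then_else_)
import Data.Bool.Properties as Bool
open import Data.Fin using (Fin; zero; suc; toℕ; fromℕ<; #_; remQuot; combine)
open import Data.Fin.Properties
  using (_≟_; ¬Fin0; suc-injective; all?; any?; remQuot-combine; combine-remQuot; combine-injectiveˡ)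
open import Data.List using ([]; _∷_; tabulate)
open import Data.List.Properties using (map-tabulate)
open import Data.Nat.ListAction using (sum)
open import Data.List.Relation.Unary.All using ([]; _∷_)
open import Data.List.Relation.Unary.AllPairs using ([]; _∷_)
open import Data.Unit using (tt)
open import Data.Empty using (⊥-elim)
open import Data.Product using (Σ; ∃; ∃₂; _×_; _,_; proj₁; proj₂; uncurry)
open import Data.Sum using (_⊎_; inj₁; inj₂)
open import Function using (id; _∘_; Equivalence)
open import Relation.Nullary using (¬_; Dec; yes; no; ⌊_⌋)
open import Relation.Nullary.Decidable
  using (¬?; _×-dec_; _⊎-dec_; _→-dec_; T?; from-yes; decidable-stable)
open import Relation.Unary using (Decidable)
open import Relation.Binary.PropositionalEquality
  using (_≡_; _≢_; refl; sym; trans; cong; cong₂; subst; subst₂)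

private
  variable
    k : ℕ
    X : Graph

-- IsMV2 X M unfolds to ∀ u v → M u → M v → u ≢ v → Visible X M u v.
Visible : (X : Graph) → (V X → Set) → V X → V X → Set
Visible X M u v = Adj X u v ⊎ (¬ Adj X u v × Σ (V X) λ w → Adj X u w × Adj X w v × ¬ M w)

trueCount : ∀ {m} → (Fin m → Bool) → ℕ
trueCount f = sum (tabulate λ w → if f w then 1 else 0)

degree≡trueCount : (X : Graph) (v : V X) → degree X v ≡ trueCount (E X v)
degree≡trueCount X v = cong sum (map-tabulate id (λ w → if E X v w then 1 else 0))

trueCount-witness : ∀ {m} (f : Fin m → Bool) → 1 ≤ trueCount f → ∃ λ y → T (f y)
trueCount-witness {suc m} f p with f zero in eq
... | true  = zero , subst T (sym eq) tt
... | false = let y , fy = trueCount-witness (f ∘ suc) p in suc y , fy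

trueCount-two-witnesses : ∀ {m} (f : Fin m → Bool) → 2 ≤ trueCount f →
                          ∃₂ λ y y' → y ≢ y' × T (f y) × T (f y')
trueCount-two-witnesses {suc m} f p with f zero in eq
... | true  = let y , fy = trueCount-witness (f ∘ suc) (≤-pred p) in
              zero , suc y , (λ ()) , subst T (sym eq) tt , fy
... | false = let y , y' , y≢y' , fy , fy' = trueCount-two-witnesses (f ∘ suc) p in
              suc y , suc y' , y≢y' ∘ suc-injective , fy , fy'

two-neighbours : (X : Graph) (v : V X) → 2 ≤ degree X v →
                 ∃₂ λ y y' → y ≢ y' × Adj X v y × Adj X v y'
two-neighbours X v δ = trueCount-two-witnesses (E X v) (subst (2 ≤_) (degree≡trueCount X v) δ)

module _ (simple : IsSimple X) where

  Adj-sym : ∀ {u v} → Adj X u v → Adj X v u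
  Adj-sym {u} {v} = subst T (proj₁ simple u v)

  Adj⇒≢ : ∀ {u v} → Adj X u v → u ≢ v
  Adj⇒≢ {u} uu refl = subst T (proj₂ simple u) uu

TriangleFree : Graph → Set
TriangleFree X = ∀ x y z → ¬ (Adj X x y × Adj X y z × Adj X z x)

SquareFree : Graph → Set
SquareFree X = ∀ x y z w → x ≢ z → y ≢ w → ¬ (Adj X x y × Adj X y z × Adj X z w × Adj X w x)

module _ (simple : IsSimple X) (girth : GirthAtLeast 5 X) where

  girth≥5⇒triangleFree : TriangleFree X
  girth≥5⇒triangleFree x y z (xy , yz , zx) with girth (x ∷ y ∷ z ∷ [])
    ( s≤s (s≤s (s≤s z≤n))
    , (Adj⇒≢ simple xy ∷ (Adj⇒≢ simple (Adj-sym simple zx)) ∷ []) ∷ (Adj⇒≢ simple yz ∷ []) ∷ [] ∷ []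
    , xy , yz , zx , tt)
  ... | s≤s (s≤s (s≤s ()))

  girth≥5⇒squareFree : SquareFree X
  girth≥5⇒squareFree x y z w x≢z y≢w (xy , yz , zw , wx) with girth (x ∷ y ∷ z ∷ w ∷ [])
    ( s≤s (s≤s (s≤s z≤n))
    , (Adj⇒≢ simple xy ∷ x≢z ∷ Adj⇒≢ simple (Adj-sym simple wx) ∷ [])
      ∷ (Adj⇒≢ simple yz ∷ y≢w ∷ []) ∷ (Adj⇒≢ simple zw ∷ []) ∷ [] ∷ []
    , xy , yz , zw , wx , tt)
  ... | s≤s (s≤s (s≤s (s≤s ())))

triangleFree∧squareFree⇒girth≥5 : TriangleFree X → SquareFree X → GirthAtLeast 5 X
triangleFree∧squareFree⇒girth≥5 noC3 noC4 (x ∷ y ∷ z ∷ []) (_ , _ , xy , yz , zx , _) =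
  ⊥-elim (noC3 x y z (xy , yz , zx))
triangleFree∧squareFree⇒girth≥5 noC3 noC4 (x ∷ y ∷ z ∷ w ∷ [])
  (_ , ((_ ∷ x≢z ∷ _) ∷ (_ ∷ y≢w ∷ _) ∷ _) , xy , yz , zw , wx , _) =
  ⊥-elim (noC4 x y z w x≢z y≢w (xy , yz , zw , wx))
triangleFree∧squareFree⇒girth≥5 _ _ (_ ∷ _ ∷ _ ∷ _ ∷ _ ∷ _) _ = s≤s (s≤s (s≤s (s≤s (s≤s z≤n))))
triangleFree∧squareFree⇒girth≥5 _ _ (_ ∷ []) (s≤s () , _)
triangleFree∧squareFree⇒girth≥5 _ _ (_ ∷ _ ∷ []) (s≤s (s≤s ()) , _)

module _ (simple : IsSimple X) (girth : GirthAtLeast 5 X) {M : V X → Set} (mv : IsMV2 X M) where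

  -- Distinct y, y' ∈ M are adjacent (a triangle with v) or have a common neighbour
  -- outside M, hence distinct from v (a 4-cycle through v).
  IsMV2-neighbour-unique : ∀ {v y y'} → M v → Adj X v y → Adj X v y' → M y → M y' → y ≡ y'
  IsMV2-neighbour-unique {v} {y} {y'} Mv vy vy' My My' = decidable-stable (y ≟ y') no-other
    where
    no-other : ¬ y ≢ y'
    no-other y≢y' with mv y y' My My' y≢y'
    ... | inj₁ yy' = girth≥5⇒triangleFree simple girth v y y' (vy , yy' , Adj-sym simple vy')
    ... | inj₂ (_ , w , yw , wy' , ¬Mw) =
      girth≥5⇒squareFree simple girth v y w y' (λ { refl → ¬Mw Mv }) y≢y'
        (vy , yw , wy' , Adj-sym simple vy')

  IsMV2-neighbour-outside : Decidable M → ∀ {v} → M v → 2 ≤ degree X v → ∃ λ x → Adj X v x × ¬ M x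
  IsMV2-neighbour-outside M? {v} Mv δ with two-neighbours X v δ
  ... | y , y' , y≢y' , vy , vy' with M? y | M? y'
  ...   | no ¬My | _       = y , vy , ¬My
  ...   | yes _  | no ¬My' = y' , vy' , ¬My'
  ...   | yes My | yes My' = ⊥-elim (y≢y' (IsMV2-neighbour-unique Mv vy vy' My My'))

module _ (G H : Graph) where

  private
    L : Graph
    L = lex G H

    pair : V G → V H → V L
    pair = combine

    split : V L → V G × V H
    split = remQuot {n G} (n H)

    lexE : V G × V H → V G × V H → Bool
    lexE (g , h) (g' , h') = E G g g' ∨ (⌊ g ≟ g' ⌋ ∧ E H h h')

    lex-E : ∀ i j → E L i j ≡ lexE (split i) (split j)
    lex-E i j with remQuot {n G} (n H) i | remQuot {n G} (n H) j
    ... | _ | _ = refl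

  lex-E-pair : ∀ g h g' h' → E L (pair g h) (pair g' h') ≡ (E G g g' ∨ (⌊ g ≟ g' ⌋ ∧ E H h h'))
  lex-E-pair g h g' h' =
    trans (lex-E (pair g h) (pair g' h')) (cong₂ lexE (remQuot-combine g h) (remQuot-combine g' h'))

  lex-Adj-pair : ∀ {g g'} h h' → Adj G g g' → Adj L (pair g h) (pair g' h')
  lex-Adj-pair {g} {g'} h h' gg' = subst T (sym (lex-E-pair g h g' h')) (Bool.T-∨ .Equivalence.from (inj₁ gg'))

  lex-E-pair-≢ : ∀ {g g'} h h' → g ≢ g' → E L (pair g h) (pair g' h') ≡ E G g g'
  lex-E-pair-≢ {g} {g'} h h' g≢g' with g ≟ g' | lex-E-pair g h g' h'
  ... | yes g≡g' | _  = ⊥-elim (g≢g' g≡g')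
  ... | no _     | eq = trans eq (Bool.∨-identityʳ (E G g g'))

  lex-E-pair-fibre : ∀ {g} h h' → E G g g ≡ false → E L (pair g h) (pair g h') ≡ E H h h'
  lex-E-pair-fibre {g} h h' gg with g ≟ g | lex-E-pair g h g h'
  ... | yes _ | eq = trans eq (cong (_∨ E H h h') gg)
  ... | no g≢g | _ = ⊥-elim (g≢g refl)

  lex-∀-pair : (P : V L → V L → Set) → (∀ g h g' h' → P (pair g h) (pair g' h')) → ∀ i j → P i j
  lex-∀-pair P P-pair i j =
    subst₂ P (combine-remQuot {n G} (n H) i) (combine-remQuot {n G} (n H) j)
      (uncurry (uncurry P-pair (split i)) (split j))

  lex-preimage : (V G → Set) → V L → Set
  lex-preimage M = M ∘ proj₁ ∘ split

  lex-preimage-pair : ∀ (M : V G → Set) g h → lex-preimage M (pair g h) → M g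
  lex-preimage-pair M g h = subst M (cong proj₁ (remQuot-combine g h))

  IsMV2-lex-preimage : IsSimple G → ∀ {M} → IsMV2 G M → (∀ {g} → M g → ∃ λ x → Adj G g x × ¬ M x) →
                       IsMV2 L (lex-preimage M)
  IsMV2-lex-preimage simple {M} mv escape = lex-∀-pair P visible
    where
    M' : V L → Set
    M' = lex-preimage M

    P : V L → V L → Set
    P u v = M' u → M' v → u ≢ v → Visible L M' u v

    visible : ∀ g h g' h' → P (pair g h) (pair g' h')
    visible g h g' h' Mgh Mg'h' _ with g ≟ g'
    ... | no g≢g' with mv g g' (lex-preimage-pair M g h Mgh) (lex-preimage-pair M g' h' Mg'h') g≢g'
    ...   | inj₁ gg' = inj₁ (lex-Adj-pair h h' gg')
    ...   | inj₂ (¬gg' , w , gw , wg' , ¬Mw) =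
      inj₂ ( ¬gg' ∘ subst T (lex-E-pair-≢ h h' g≢g') , pair w h
           , lex-Adj-pair h h gw , lex-Adj-pair h h' wg' , ¬Mw ∘ lex-preimage-pair M w h)
    visible g h _ h' Mgh _ _ | yes refl = same-fibre (T? (E H h h'))
      where
      fibre : E L (pair g h) (pair g h') ≡ E H h h'
      fibre = lex-E-pair-fibre h h' (proj₂ simple g)

      same-fibre : Dec (Adj H h h') → Visible L M' (pair g h) (pair g h')
      same-fibre (yes hh') = inj₁ (subst T (sym fibre) hh')
      same-fibre (no ¬hh') =
        let x , gx , ¬Mx = escape (lex-preimage-pair M g h Mgh) in
        inj₂ ( ¬hh' ∘ subst T fibre , pair x h
             , lex-Adj-pair h h gx , lex-Adj-pair h h' (Adj-sym simple gx) , ¬Mx ∘ lex-preimage-pair M x h)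

HasMV2Partition-lex : ∀ {G} H → IsSimple G → MinDegreeAtLeast 2 G → GirthAtLeast 5 G →
                      HasMV2Partition G k → HasMV2Partition (lex G H) k
HasMV2Partition-lex {G = G} H simple δ girth (c , mv) =
  c ∘ proj₁ ∘ remQuot {n G} (n H) ,
  λ i → IsMV2-lex-preimage G H simple (mv i)
          (λ {g} cg≡i → IsMV2-neighbour-outside simple girth (mv i) (λ x → c x ≟ i) cg≡i (δ g))

χμ2-lex≤χμ2 : (G H : Graph) → IsSimple G → IsSimple H →
              MinDegreeAtLeast 2 G → GirthAtLeast 5 G →
              (a b : ℕ) → ChiMu2 G a → ChiMu2 (lex G H) b → b ≤ a
χμ2-lex≤χμ2 G H simple _ δ girth a b (partition , _) (_ , minimal) =
  minimal a (HasMV2Partition-lex H simple δ girth partition)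

HasMV2Partition⇒2≤ : (u v : V X) → u ≢ v → ¬ Adj X u v → HasMV2Partition X k → 2 ≤ k
HasMV2Partition⇒2≤ {k = zero} u _ _ _ (c , _) = ⊥-elim (¬Fin0 (c u))
HasMV2Partition⇒2≤ {X = X} {k = suc zero} u v u≢v ¬uv (c , mv) =
  ⊥-elim (invisible (mv zero u v (all-zero (c u)) (all-zero (c v)) u≢v))
  where
  all-zero : (i : Fin 1) → i ≡ zero
  all-zero zero = refl

  invisible : ¬ Visible X (λ x → c x ≡ zero) u v
  invisible (inj₁ uv) = ¬uv uv
  invisible (inj₂ (_ , w , _ , _ , ¬Mw)) = ¬Mw (all-zero (c w))
HasMV2Partition⇒2≤ {k = suc (suc _)} _ _ _ _ _ = s≤s (s≤s z≤n)

IsSimple? : (X : Graph) → Dec (IsSimple X)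
IsSimple? X = all? (λ u → all? λ v → E X u v Bool.≟ E X v u) ×-dec all? (λ u → E X u u Bool.≟ false)

MinDegreeAtLeast? : ∀ d X → Dec (MinDegreeAtLeast d X)
MinDegreeAtLeast? d X = all? λ v → d ≤? degree X v

TriangleFree? : (X : Graph) → Dec (TriangleFree X)
TriangleFree? X = all? λ x → all? λ y → all? λ z → ¬? (T? (E X x y) ×-dec T? (E X y z) ×-dec T? (E X z x))

SquareFree? : (X : Graph) → Dec (SquareFree X)
SquareFree? X = all? λ x → all? λ y → all? λ z → all? λ w →
  ¬? (x ≟ z) →-dec ¬? (y ≟ w) →-dec
  ¬? (T? (E X x y) ×-dec T? (E X y z) ×-dec T? (E X z w) ×-dec T? (E X w x))

IsMV2? : (X : Graph) {M : V X → Set} → Decidable M → Dec (IsMV2 X M)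
IsMV2? X {M} M? = all? λ u → all? λ v → M? u →-dec M? v →-dec ¬? (u ≟ v) →-dec visible? u v
  where
  visible? : ∀ u v → Dec (Visible X M u v)
  visible? u v = T? (E X u v) ⊎-dec ¬? (T? (E X u v)) ×-dec
                 any? λ w → T? (E X u w) ×-dec T? (E X w v) ×-dec ¬? (M? w)

C5 : Graph
C5 = mkGraph 5 λ u v → ⌊ suc (toℕ u) % 5 ℕ.≟ toℕ v ⌋ ∨ ⌊ suc (toℕ v) % 5 ℕ.≟ toℕ u ⌋

C5-simple : IsSimple C5
C5-simple = from-yes (IsSimple? C5)

C5-minDegree : MinDegreeAtLeast 2 C5
C5-minDegree = from-yes (MinDegreeAtLeast? 2 C5)

C5-girth : GirthAtLeast 5 C5
C5-girth = triangleFree∧squareFree⇒girth≥5 (from-yes (TriangleFree? C5)) (from-yes (SquareFree? C5))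

C5-partition : HasMV2Partition C5 2
C5-partition = parity , from-yes (all? λ i → IsMV2? C5 λ x → parity x ≟ i)
  where
  parity : Fin 5 → Fin 2
  parity v = toℕ v mod 2

lex-C5-partition⇒2≤ : ∀ H → 1 ≤ n H → HasMV2Partition (lex C5 H) k → 2 ≤ k
lex-C5-partition⇒2≤ H nH =
  HasMV2Partition⇒2≤ (combine v₀ h) (combine v₂ h)
    (λ eq → v₀≢v₂ (combine-injectiveˡ v₀ h v₂ h eq))
    (subst T (lex-E-pair-≢ C5 H h h v₀≢v₂))
  where
  h : V H
  h = fromℕ< nH

  v₀ v₂ : V C5
  v₀ = # 0
  v₂ = # 2

  v₀≢v₂ : v₀ ≢ v₂
  v₀≢v₂ ()

theorem4p2 :
    ((G H : Graph) → IsSimple G → IsSimple H →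
      MinDegreeAtLeast 2 G → GirthAtLeast 5 G →
      (a b : ℕ) → ChiMu2 G a → ChiMu2 (lex G H) b → b ≤ a)
    ×
    Σ Graph (λ G → IsSimple G × 1 ≤ n G × MinDegreeAtLeast 2 G × GirthAtLeast 5 G ×
      ((H : Graph) → IsSimple H → 1 ≤ n H →
        (a b : ℕ) → ChiMu2 G a → ChiMu2 (lex G H) b → b ≡ a))
theorem4p2 = χμ2-lex≤χμ2 , C5 , C5-simple , s≤s z≤n , C5-minDegree , C5-girth , sharp
  where
  sharp : (H : Graph) → IsSimple H → 1 ≤ n H →
          (a b : ℕ) → ChiMu2 C5 a → ChiMu2 (lex C5 H) b → b ≡ a
  sharp H simpleH nH a b χa χb = ≤-antisym
    (χμ2-lex≤χμ2 C5 H C5-simple simpleH C5-minDegree C5-girth a b χa χb)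
    (begin
      a ≤⟨ proj₂ χa 2 C5-partition ⟩
      2 ≤⟨ lex-C5-partition⇒2≤ H nH (proj₁ χb) ⟩
      b ∎)
    where open ≤-Reasoning
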